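{- Let $m$ and $n$ be non-negative integers. Then $$ \sum_{k=1}^{m}\binom{n+k-2}{k-1}\binom{n-1}{k-1}\binom{m+n}{m-k} =\sum_{k=0}^m k\binom{m+n-k-1}{n-1}^2. $$ -}

module Defs where

open import Data.Nat using (ℕ; zero; suc)
open import Data.Integer using (ℤ; +_; -[1+_]; _+_; _*_)
open import Data.Nat.Combinatorics using (_C_)

binom : ℤ → ℤ → ℤ
binom (+ a) (+ b) = + (a C b)
binom (+ a) -[1+ b ] = + 0
binom -[1+ a ] b = + 0

sumFrom : ℕ → ℕ → (ℕ → ℤ) → ℤ
sumFrom lo zero f = + 0
sumFrom lo (suc len) f = f lo + sumFrom (suc lo) len f

-- Σ_{k=lo}^{hi} f k (empty if hi < lo)
sumRange : ℕ → ℕ → (ℕ → ℤ) → ℤ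
sumRange lo hi f = sumFrom lo (suc hi Data.Nat.∸ lo) f

module Submission where

-- Write n = N + 1 and shift the left index k = j + 1.  Over ℕ the theorem reads
--   L m := Σ_{j<m} a_j · C(m+N+1, m−1−j)  =  R m := Σ_{k≤m} k · C(m−k+N, N)²,
-- with a_j = C(j+N, j) · C(N, j).  Both sides vanish at m = 0 and have the same
-- first difference.  Writing s_j = C(j+N, j)²:
--   R(m+1) = R m + Σ_{k≤m} C(m−k+N, N)² = R m + Σ_{j≤m} s_j   (reverse the sum),
--   L(m+1) = L m + P m,  P m := Σ_{j≤m} a_j · C(m+N+1, m−j)   (Pascal's rule),
-- and P m = Σ_{j≤m} s_j, since Pascal's rule again gives P m − P(m−1) =
-- Σ_{i≤m} a_i · C(m+N, m−i), which equals s_m by trinomial revision followed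
-- by Vandermonde's convolution.  For n = 0 the statement is degenerate: every
-- term contains a binomial coefficient with a negative argument.

module FiniteSums where
  open import Data.Nat using (ℕ; zero; suc; _+_; _*_; _∸_; _<_; z<s; s<s; s≤s⁻¹)
  open import Data.Nat.Properties
    using (+-comm; +-assoc; *-zeroʳ; *-distribˡ-+; +-∸-assoc; n∸n≡0)
  open import Data.Nat.Tactic.RingSolver using (solve-∀)
  open import Relation.Binary.PropositionalEquality

  ∑< : ℕ → (ℕ → ℕ) → ℕ
  ∑< zero    f = 0
  ∑< (suc n) f = f 0 + ∑< n (λ i → f (suc i))

  syntax ∑< n (λ i → e) = ∑[ i < n ] e

  ∑-cong : ∀ n {f g : ℕ → ℕ} → (∀ i → i < n → f i ≡ g i) → ∑< n f ≡ ∑< n g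
  ∑-cong zero    agree = refl
  ∑-cong (suc n) agree =
    cong₂ _+_ (agree 0 z<s) (∑-cong n (λ i i<n → agree (suc i) (s<s i<n)))

  ∑-zero : ∀ n → ∑[ i < n ] 0 ≡ 0
  ∑-zero zero    = refl
  ∑-zero (suc n) = ∑-zero n

  ∑-+ : ∀ n (f g : ℕ → ℕ) → ∑[ i < n ] (f i + g i) ≡ ∑< n f + ∑< n g
  ∑-+ zero    f g = refl
  ∑-+ (suc n) f g = begin
    f 0 + g 0 + ∑[ i < n ] (f (suc i) + g (suc i))
      ≡⟨ cong (f 0 + g 0 +_) (∑-+ n _ _) ⟩
    f 0 + g 0 + (∑[ i < n ] f (suc i) + ∑[ i < n ] g (suc i))
      ≡⟨ interchange (f 0) (g 0) _ _ ⟩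
    (f 0 + ∑[ i < n ] f (suc i)) + (g 0 + ∑[ i < n ] g (suc i)) ∎
    where
    open ≡-Reasoning
    interchange : ∀ a b c d → a + b + (c + d) ≡ (a + c) + (b + d)
    interchange = solve-∀

  ∑-*ˡ : ∀ n c (f : ℕ → ℕ) → ∑[ i < n ] (c * f i) ≡ c * ∑< n f
  ∑-*ˡ zero    c f = sym (*-zeroʳ c)
  ∑-*ˡ (suc n) c f =
    trans (cong (c * f 0 +_) (∑-*ˡ n c _)) (sym (*-distribˡ-+ c (f 0) _))

  ∑-last : ∀ n (f : ℕ → ℕ) → ∑< (suc n) f ≡ ∑< n f + f n
  ∑-last zero    f = +-comm (f 0) 0
  ∑-last (suc n) f = trans (cong (f 0 +_) (∑-last n _)) (sym (+-assoc (f 0) _ _))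

  _⋆_ : (ℕ → ℕ) → (ℕ → ℕ) → ℕ → ℕ
  (f ⋆ g) m = ∑[ i < suc m ] (f i * g (m ∸ i))

  ⋆-congʳ : ∀ f {g h : ℕ → ℕ} m → (∀ t → g t ≡ h t) → (f ⋆ g) m ≡ (f ⋆ h) m
  ⋆-congʳ f m g≗h = ∑-cong (suc m) (λ i _ → cong (f i *_) (g≗h (m ∸ i)))

  ⋆-zeroʳ : ∀ f m → (f ⋆ (λ _ → 0)) m ≡ 0
  ⋆-zeroʳ f m = trans (∑-cong (suc m) (λ i _ → *-zeroʳ (f i))) (∑-zero (suc m))

  ⋆-+ʳ : ∀ f g h m → (f ⋆ (λ t → g t + h t)) m ≡ (f ⋆ g) m + (f ⋆ h) m
  ⋆-+ʳ f g h m =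
    trans (∑-cong (suc m) (λ i _ → *-distribˡ-+ (f i) (g (m ∸ i)) (h (m ∸ i))))
          (∑-+ (suc m) (λ i → f i * g (m ∸ i)) (λ i → f i * h (m ∸ i)))

  ⋆-suc : ∀ f g m → (f ⋆ g) (suc m) ≡ (f ⋆ (λ t → g (suc t))) m + f (suc m) * g 0
  ⋆-suc f g m = trans (∑-last (suc m) (λ i → f i * g (suc m ∸ i)))
    (cong₂ _+_ (∑-cong (suc m) (λ i i≤m → cong (λ t → f i * g t) (+-∸-assoc 1 (s≤s⁻¹ i≤m))))
               (cong (λ t → f (suc m) * g t) (n∸n≡0 m)))

module Binomials where
  open import Data.Nat
    using (ℕ; zero; suc; _+_; _*_; _∸_; _≤_; _!)
  open import Data.Nat.Properties
    using (+-identityʳ; +-comm; +-assoc; +-suc; *-identityʳ; *-cancelʳ-≡; m≤m+n; m+n∸m≡n;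
           m*n≢0; _!≢0; _!*_!≢0)
  open import Data.Nat.Combinatorics using (_C_; nCk≡nC[n∸k]; nCk≡n!/k![n-k]!; k![n∸k]!∣n!; nCk+nC[k+1]≡[n+1]C[k+1])
  open import Data.Nat.DivMod using (m/n*n≡m)
  open import Data.Nat.Tactic.RingSolver using (solve-∀)
  open import Relation.Binary.PropositionalEquality
  open FiniteSums

  C-sym : ∀ a b → (a + b) C a ≡ (a + b) C b
  C-sym a b = trans (nCk≡nC[n∸k] (m≤m+n a b)) (cong ((a + b) C_) (m+n∸m≡n a b))

  -- The factorial formula n! = C(n, k) · k! · (n − k)!, in cancellation-free form.
  C-factorial : ∀ {n k} → k ≤ n → (n C k) * (k ! * (n ∸ k) !) ≡ n !
  C-factorial {n} {k} k≤n =
    trans (cong (_* (k ! * (n ∸ k) !)) (nCk≡n!/k![n-k]! k≤n)) (m/n*n≡m (k![n∸k]!∣n! k≤n))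
    where instance _ = k !* (n ∸ k) !≢0

  C-factorialˡ : ∀ a b → ((a + b) C a) * (a ! * b !) ≡ (a + b) !
  C-factorialˡ a b =
    subst (λ x → ((a + b) C a) * (a ! * x !) ≡ (a + b) !) (m+n∸m≡n a b) (C-factorial (m≤m+n a b))

  C-factorialʳ : ∀ a b → ((a + b) C b) * (a ! * b !) ≡ (a + b) !
  C-factorialʳ a b = trans (cong (_* (a ! * b !)) (sym (C-sym a b))) (C-factorialˡ a b)

  -- Trinomial revision: both sides equal (a+b+c)! / (a! b! c!).
  trinomial-revision : ∀ a b c →
    ((a + b) C a) * (((a + c) + b) C c) ≡ (((a + c) + b) C (a + c)) * ((a + c) C c)
  trinomial-revision a b c = *-cancelʳ-≡ _ _ (a ! * (b ! * c !)) (trans lhs (sym rhs))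
    where
    instance _ = m*n≢0 (a !) (b ! * c !) {{a !≢0}} {{b !* c !≢0}}
    open ≡-Reasoning
    regroupˡ : ∀ x y p q r → x * y * (p * (q * r)) ≡ y * (x * (p * q) * r)
    regroupˡ = solve-∀
    regroupʳ : ∀ x y p q r → x * y * (p * (q * r)) ≡ x * (y * (p * r) * q)
    regroupʳ = solve-∀
    reorder : (a + b) + c ≡ (a + c) + b
    reorder = trans (+-assoc a b c) (trans (cong (a +_) (+-comm b c)) (sym (+-assoc a c b)))
    lhs : ((a + b) C a) * (((a + c) + b) C c) * (a ! * (b ! * c !)) ≡ ((a + c) + b) !
    lhs = begin
      ((a + b) C a) * (((a + c) + b) C c) * (a ! * (b ! * c !))
        ≡⟨ regroupˡ ((a + b) C a) _ (a !) (b !) (c !) ⟩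
      (((a + c) + b) C c) * (((a + b) C a) * (a ! * b !) * c !)
        ≡⟨ cong (λ z → (((a + c) + b) C c) * (z * c !)) (C-factorialˡ a b) ⟩
      (((a + c) + b) C c) * ((a + b) ! * c !)
        ≡⟨ subst (λ x → (x C c) * ((a + b) ! * c !) ≡ x !) reorder (C-factorialʳ (a + b) c) ⟩
      ((a + c) + b) ! ∎
    rhs : (((a + c) + b) C (a + c)) * ((a + c) C c) * (a ! * (b ! * c !)) ≡ ((a + c) + b) !
    rhs = begin
      (((a + c) + b) C (a + c)) * ((a + c) C c) * (a ! * (b ! * c !))
        ≡⟨ regroupʳ (((a + c) + b) C (a + c)) _ (a !) (b !) (c !) ⟩
      (((a + c) + b) C (a + c)) * (((a + c) C c) * (a ! * c !) * b !)
        ≡⟨ cong (λ z → (((a + c) + b) C (a + c)) * (z * b !)) (C-factorialʳ a c) ⟩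
      (((a + c) + b) C (a + c)) * ((a + c) ! * b !)
        ≡⟨ C-factorialˡ (a + c) b ⟩
      ((a + c) + b) ! ∎

  -- Pascal's rule C(u+1, t+1) = C(u, t) + C(u, t+1), applied under a convolution.
  ⋆-pascal : ∀ f u m → (f ⋆ (suc u C_)) (suc m) ≡ (f ⋆ (u C_)) (suc m) + (f ⋆ (u C_)) m
  ⋆-pascal f u m = begin
    (f ⋆ (suc u C_)) (suc m)
      ≡⟨ ⋆-suc f (suc u C_) m ⟩
    (f ⋆ (λ t → suc u C suc t)) m + f (suc m) * 1
      ≡⟨ cong (_+ f (suc m) * 1) (⋆-congʳ f m (λ t → sym (nCk+nC[k+1]≡[n+1]C[k+1] u t))) ⟩
    (f ⋆ (λ t → u C t + u C suc t)) m + f (suc m) * 1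
      ≡⟨ cong (_+ f (suc m) * 1) (⋆-+ʳ f (u C_) (λ t → u C suc t) m) ⟩
    (f ⋆ (u C_)) m + (f ⋆ (λ t → u C suc t)) m + f (suc m) * 1
      ≡⟨ +-assoc ((f ⋆ (u C_)) m) _ _ ⟩
    (f ⋆ (u C_)) m + ((f ⋆ (λ t → u C suc t)) m + f (suc m) * 1)
      ≡⟨ cong ((f ⋆ (u C_)) m +_) (sym (⋆-suc f (u C_) m)) ⟩
    (f ⋆ (u C_)) m + (f ⋆ (u C_)) (suc m)
      ≡⟨ +-comm ((f ⋆ (u C_)) m) _ ⟩
    (f ⋆ (u C_)) (suc m) + (f ⋆ (u C_)) m ∎
    where open ≡-Reasoning

  ⋆-C0 : ∀ f m → (f ⋆ (0 C_)) m ≡ f m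
  ⋆-C0 f zero    = trans (+-identityʳ (f 0 * 1)) (*-identityʳ (f 0))
  ⋆-C0 f (suc m) = trans (⋆-suc f (0 C_) m) (cong₂ _+_ (⋆-zeroʳ f m) (*-identityʳ (f (suc m))))

  vandermonde : ∀ N u m → ((N C_) ⋆ (u C_)) m ≡ (N + u) C m
  vandermonde N zero    m = trans (⋆-C0 (N C_) m) (cong (_C m) (sym (+-identityʳ N)))
  vandermonde N (suc u) zero    = refl
  vandermonde N (suc u) (suc m) = begin
    ((N C_) ⋆ (suc u C_)) (suc m)
      ≡⟨ ⋆-pascal (N C_) u m ⟩
    ((N C_) ⋆ (u C_)) (suc m) + ((N C_) ⋆ (u C_)) m
      ≡⟨ cong₂ _+_ (vandermonde N u (suc m)) (vandermonde N u m) ⟩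
    (N + u) C suc m + (N + u) C m
      ≡⟨ +-comm ((N + u) C suc m) _ ⟩
    (N + u) C m + (N + u) C suc m
      ≡⟨ nCk+nC[k+1]≡[n+1]C[k+1] (N + u) m ⟩
    suc (N + u) C suc m
      ≡⟨ cong (_C suc m) (sym (+-suc N u)) ⟩
    (N + suc u) C suc m ∎
    where open ≡-Reasoning

module NaturalIdentity where
  open import Data.Nat using (ℕ; zero; suc; _+_; _*_; _∸_; _≤_; s≤s⁻¹)
  open import Data.Nat.Properties using (+-comm; +-suc; m+[n∸m]≡n)
  open import Data.Nat.Combinatorics using (_C_)
  open import Data.Nat.Tactic.RingSolver using (solve-∀)
  open import Relation.Binary.PropositionalEquality
  open FiniteSums
  open Binomials

  coeff : ℕ → ℕ → ℕ
  coeff N j = ((j + N) C j) * (N C j)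

  square : ℕ → ℕ → ℕ
  square N j = ((j + N) C j) * ((j + N) C j)

  squareSum : ℕ → ℕ → ℕ
  squareSum N m = ∑[ j < suc m ] square N j

  -- Trinomial revision moves the dependence on i out of the upper index.
  coeff-revision : ∀ N i t →
    coeff N i * (((i + t) + N) C t) ≡ (((i + t) + N) C (i + t)) * ((N C i) * ((i + t) C t))
  coeff-revision N i t = begin
    ((i + N) C i) * (N C i) * (((i + t) + N) C t)
      ≡⟨ swap ((i + N) C i) (N C i) _ ⟩
    ((i + N) C i) * (((i + t) + N) C t) * (N C i)
      ≡⟨ cong (_* (N C i)) (trinomial-revision i N t) ⟩
    (((i + t) + N) C (i + t)) * ((i + t) C t) * (N C i)
      ≡⟨ reassoc (((i + t) + N) C (i + t)) _ _ ⟩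
    (((i + t) + N) C (i + t)) * ((N C i) * ((i + t) C t)) ∎
    where
    open ≡-Reasoning
    swap : ∀ x y z → x * y * z ≡ x * z * y
    swap = solve-∀
    reassoc : ∀ x y z → x * y * z ≡ x * (z * y)
    reassoc = solve-∀

  coeff-⋆ : ∀ N j → (coeff N ⋆ ((j + N) C_)) j ≡ square N j
  coeff-⋆ N j = begin
    (coeff N ⋆ ((j + N) C_)) j
      ≡⟨ ∑-cong (suc j) (λ i i≤j → revised i (s≤s⁻¹ i≤j)) ⟩
    ∑[ i < suc j ] (((j + N) C j) * ((N C i) * (j C (j ∸ i))))
      ≡⟨ ∑-*ˡ (suc j) ((j + N) C j) (λ i → (N C i) * (j C (j ∸ i))) ⟩
    ((j + N) C j) * ((N C_) ⋆ (j C_)) j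
      ≡⟨ cong (((j + N) C j) *_) (vandermonde N j j) ⟩
    ((j + N) C j) * ((N + j) C j)
      ≡⟨ cong (λ x → ((j + N) C j) * (x C j)) (+-comm N j) ⟩
    square N j ∎
    where
    open ≡-Reasoning
    revised : ∀ i → i ≤ j → coeff N i * ((j + N) C (j ∸ i)) ≡ ((j + N) C j) * ((N C i) * (j C (j ∸ i)))
    revised i i≤j = subst (λ x → coeff N i * ((x + N) C (j ∸ i)) ≡ ((x + N) C x) * ((N C i) * (x C (j ∸ i))))
                          (m+[n∸m]≡n i≤j) (coeff-revision N i (j ∸ i))

  P : ℕ → ℕ → ℕ
  P N m = (coeff N ⋆ ((m + suc N) C_)) m

  P≡squareSum : ∀ N m → P N m ≡ squareSum N m
  P≡squareSum N zero    = refl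
  P≡squareSum N (suc m) = begin
    P N (suc m)
      ≡⟨ ⋆-pascal (coeff N) (m + suc N) m ⟩
    (coeff N ⋆ ((m + suc N) C_)) (suc m) + P N m
      ≡⟨ cong₂ _+_ (trans (cong (λ u → (coeff N ⋆ (u C_)) (suc m)) (+-suc m N)) (coeff-⋆ N (suc m)))
                   (P≡squareSum N m) ⟩
    square N (suc m) + squareSum N m
      ≡⟨ +-comm (square N (suc m)) _ ⟩
    squareSum N m + square N (suc m)
      ≡⟨ sym (∑-last (suc m) (square N)) ⟩
    squareSum N (suc m) ∎
    where open ≡-Reasoning

  lhsTerm : ℕ → ℕ → ℕ → ℕ
  lhsTerm N m j = coeff N j * ((m + suc N) C (m ∸ suc j))

  lhsℕ : ℕ → ℕ → ℕ
  lhsℕ N m = ∑[ j < m ] lhsTerm N m j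

  rhsTerm : ℕ → ℕ → ℕ → ℕ
  rhsTerm N m k = k * ((((m ∸ k) + N) C N) * (((m ∸ k) + N) C N))

  rhsℕ : ℕ → ℕ → ℕ
  rhsℕ N m = ∑[ k < suc m ] rhsTerm N m k

  lhs-step : ∀ N m → lhsℕ N (suc m) ≡ lhsℕ N m + P N m
  lhs-step N zero    = refl
  lhs-step N (suc m) = trans (⋆-pascal (coeff N) (suc m + suc N) m) (+-comm (P N (suc m)) _)

  reversed-squareSum : ∀ N m → ∑[ k < suc m ] ((((m ∸ k) + N) C N) * (((m ∸ k) + N) C N)) ≡ squareSum N m
  reversed-squareSum N zero    = cong (λ x → x * x + 0) (sym (C-sym 0 N))
  reversed-squareSum N (suc m) = begin
    ((suc m + N) C N) * ((suc m + N) C N) + ∑[ k < suc m ] ((((m ∸ k) + N) C N) * (((m ∸ k) + N) C N))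
      ≡⟨ cong₂ _+_ (cong (λ x → x * x) (sym (C-sym (suc m) N))) (reversed-squareSum N m) ⟩
    square N (suc m) + squareSum N m
      ≡⟨ +-comm (square N (suc m)) _ ⟩
    squareSum N m + square N (suc m)
      ≡⟨ sym (∑-last (suc m) (square N)) ⟩
    squareSum N (suc m) ∎
    where open ≡-Reasoning

  -- Since (k+1)·x = x + k·x, the right-hand side grows by the reversed square sum.
  rhs-step : ∀ N m → rhsℕ N (suc m) ≡ rhsℕ N m + squareSum N m
  rhs-step N m = begin
    rhsℕ N (suc m)
      ≡⟨ ∑-+ (suc m) (λ k → sq k) (λ k → k * sq k) ⟩
    ∑[ k < suc m ] sq k + rhsℕ N m
      ≡⟨ cong (_+ rhsℕ N m) (reversed-squareSum N m) ⟩
    squareSum N m + rhsℕ N m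
      ≡⟨ +-comm (squareSum N m) _ ⟩
    rhsℕ N m + squareSum N m ∎
    where
    open ≡-Reasoning
    sq : ℕ → ℕ
    sq k = (((m ∸ k) + N) C N) * (((m ∸ k) + N) C N)

  identityℕ : ∀ N m → lhsℕ N m ≡ rhsℕ N m
  identityℕ N zero    = refl
  identityℕ N (suc m) = begin
    lhsℕ N (suc m)               ≡⟨ lhs-step N m ⟩
    lhsℕ N m + P N m             ≡⟨ cong₂ _+_ (identityℕ N m) (P≡squareSum N m) ⟩
    rhsℕ N m + squareSum N m     ≡⟨ sym (rhs-step N m) ⟩
    rhsℕ N (suc m) ∎
    where open ≡-Reasoning

open import Defs
open import Data.Nat using (ℕ)
open import Data.Integer using (ℤ; +_; _+_; _-_; _*_)
open import Relation.Binary.PropositionalEquality using (_≡_)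

open import Data.Nat as ℕ using (zero; suc; _∸_; _<_; _≤_; z<s; s<s; s≤s⁻¹)
import Data.Nat.Properties as ℕ
import Data.Integer as ℤ
import Data.Integer.Properties as ℤ
open import Data.Nat.Combinatorics using (_C_)
open import Data.Nat.Tactic.RingSolver using (solve-∀)
open import Relation.Binary.PropositionalEquality using (refl; sym; trans; cong; cong₂; subst)
open FiniteSums using (∑<; ∑-zero)
open NaturalIdentity using (lhsTerm; rhsTerm; identityℕ)

+-minus : ∀ {a} x {c} → a ≡ x ℕ.+ c → + a - + x ≡ + c
+-minus x {c} refl =
  trans (ℤ.m-n≡m⊖n (x ℕ.+ c) x) (trans (ℤ.⊖-≥ (ℕ.m≤m+n x c)) (cong +_ (ℕ.m+n∸m≡n x c)))

pos-*₃ : ∀ x y z → + x * + y * + z ≡ + (x ℕ.* y ℕ.* z)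
pos-*₃ x y z = trans (cong (_* + z) (sym (ℤ.pos-* x y))) (sym (ℤ.pos-* (x ℕ.* y) z))

sumFrom-pos : ∀ lo len (f : ℕ → ℤ) (h : ℕ → ℕ) →
  (∀ i → i < len → f (lo ℕ.+ i) ≡ + h i) → sumFrom lo len f ≡ + ∑< len h
sumFrom-pos lo zero      f h agree = refl
sumFrom-pos lo (suc len) f h agree = cong₂ _+_ first rest
  where
  first : f lo ≡ + h 0
  first = subst (λ k → f k ≡ + h 0) (ℕ.+-identityʳ lo) (agree 0 z<s)
  rest : sumFrom (suc lo) len f ≡ + ∑< len (λ i → h (suc i))
  rest = sumFrom-pos (suc lo) len f (λ i → h (suc i))
    (λ i i<len → subst (λ k → f k ≡ + h (suc i)) (ℕ.+-suc lo i) (agree (suc i) (s<s i<len)))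

sumFrom-zero : ∀ lo len (f : ℕ → ℤ) → (∀ i → i < len → f (lo ℕ.+ i) ≡ + 0) → sumFrom lo len f ≡ + 0
sumFrom-zero lo len f vanish = trans (sumFrom-pos lo len f (λ _ → 0) vanish) (cong +_ (∑-zero len))

binom-neg : ∀ x → binom x (+ 0 - + 1) ≡ + 0
binom-neg (+ a)      = refl
binom-neg ℤ.-[1+ a ] = refl

lhs-term-degenerate : ∀ m k →
  binom (+ 0 + + k - + 2) (+ k - + 1) * binom (+ 0 - + 1) (+ k - + 1) * binom (+ m + + 0) (+ m - + k) ≡ + 0
lhs-term-degenerate m k =
  trans (cong (_* binom (+ m + + 0) (+ m - + k)) (ℤ.*-zeroʳ (binom (+ 0 + + k - + 2) (+ k - + 1))))
        (ℤ.*-zeroˡ (binom (+ m + + 0) (+ m - + k)))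

rhs-term-degenerate : ∀ k x → + k * (binom x (+ 0 - + 1) * binom x (+ 0 - + 1)) ≡ + 0
rhs-term-degenerate k x = trans (cong (λ z → + k * (z * z)) (binom-neg x)) (ℤ.*-zeroʳ (+ k))

lhs-term : ∀ N m i → i < m →
  binom (+ suc N + + suc i - + 2) (+ suc i - + 1) * binom (+ suc N - + 1) (+ suc i - + 1)
    * binom (+ m + + suc N) (+ m - + suc i)
  ≡ + lhsTerm N m i
lhs-term N m i i<m =
  trans (cong₂ _*_ (cong₂ _*_ (cong₂ binom upper₁ lower) (cong₂ binom (+-minus 1 refl) lower))
                   (cong (binom (+ (m ℕ.+ suc N))) (+-minus (suc i) (sym (ℕ.m+[n∸m]≡n i<m)))))
        (pos-*₃ ((i ℕ.+ N) C i) (N C i) ((m ℕ.+ suc N) C (m ∸ suc i)))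
  where
  shift : ∀ N i → suc N ℕ.+ suc i ≡ 2 ℕ.+ (i ℕ.+ N)
  shift = solve-∀
  upper₁ : + suc N + + suc i - + 2 ≡ + (i ℕ.+ N)
  upper₁ = +-minus 2 (shift N i)
  lower : + suc i - + 1 ≡ + i
  lower = +-minus 1 refl

rhs-term : ∀ N m k → k ≤ m →
  + k * (binom (+ m + + suc N - + k - + 1) (+ suc N - + 1) * binom (+ m + + suc N - + k - + 1) (+ suc N - + 1))
  ≡ + rhsTerm N m k
rhs-term N m k k≤m =
  trans (cong (λ z → + k * (binom z (+ N) * binom z (+ N))) (trans (cong (_- + 1) (+-minus k split)) (+-minus 1 refl)))
        (trans (cong (+ k *_) (sym (ℤ.pos-* c c))) (sym (ℤ.pos-* k (c ℕ.* c))))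
  where
  c : ℕ
  c = ((m ∸ k) ℕ.+ N) C N
  regroup : ∀ k d N → (k ℕ.+ d) ℕ.+ suc N ≡ k ℕ.+ suc (d ℕ.+ N)
  regroup = solve-∀
  split : m ℕ.+ suc N ≡ k ℕ.+ suc ((m ∸ k) ℕ.+ N)
  split = trans (cong (ℕ._+ suc N) (sym (ℕ.m+[n∸m]≡n k≤m))) (regroup k (m ∸ k) N)

theorem1p3 : (m n : ℕ) →
    sumRange 1 m (λ k → binom (+ n + + k - + 2) (+ k - + 1) * binom (+ n - + 1) (+ k - + 1) * binom (+ m + + n) (+ m - + k))
      ≡ sumRange 0 m (λ k → + k * (binom (+ m + + n - + k - + 1) (+ n - + 1) * binom (+ m + + n - + k - + 1) (+ n - + 1)))
theorem1p3 m zero =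
  trans (sumFrom-zero 1 m _ (λ i _ → lhs-term-degenerate m (suc i)))
        (sym (sumFrom-zero 0 (suc m) _ (λ k _ → rhs-term-degenerate k (+ m + + 0 - + k - + 1))))
theorem1p3 m (suc N) =
  trans (sumFrom-pos 1 m _ (lhsTerm N m) (lhs-term N m))
        (trans (cong +_ (identityℕ N m))
               (sym (sumFrom-pos 0 (suc m) _ (rhsTerm N m) (λ k k≤m → rhs-term N m k (s≤s⁻¹ k≤m)))))
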